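{- Let $\mathcal R=(\mathcal F,\Pi,\mu,E,H,R)$ be an EGTRS and let $\beta:\lambda\to\rho\Leftarrow\gamma\in\overleftrightarrow E$ ($\lambda$ possibly a variable) be left-$\mu$-homogeneous and $\mu$-compatible. For $x\in\mathcal{V}ar^\mu(\lambda)$, $p\in\mathcal{P}os^\mu_x(\lambda)$ and fresh $x'$, let $\pi^{ps}_{\beta,x,p}$ be $\langle\lambda[x']_p,\rho\rangle\Leftarrow x\to_{ps}x',\gamma$. Then $\pi^{ps}_{\beta,x,p}$ is joinable modulo $E$ w.r.t. $\to_{\mathcal R,E}$. Furthermore, (1) if $x$ occurs more than once in $\lambda$, then it is left-strictly joinable modulo $E$ w.r.t. $\to_{\mathcal R,E}$; (2) if $x\in\mathcal{V}ar^\mu(\rho)$, then it is right-strictly joinable modulo $E$ w.r.t. $\to_{\mathcal R,E}$.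
   Context: Terms over a signature $\mathcal F$ and countable variables $\mathcal X$. A replacement map $\mu$ assigns to each $k$-ary $f$ a set $\mu(f)\subseteq\{1,..,k\}$; active positions: $\mathcal{P}os^\mu(x)=\{\Lambda\}$, $\mathcal{P}os^\mu(f(t_1,..,t_k))=\{\Lambda\}\cup\{i.q\mid i\in\mu(f),q\in\mathcal{P}os^\mu(t_i)\}$; $\mathcal{P}os^\mu_x(t)$ the active positions of $x$; $\mathcal{V}ar^\mu(t)$ (resp. $\overline{\mathcal{V}ar}^\mu(t)$) the variables with an active (resp. non-active) occurrence. A rule $\lambda\to\rho\Leftarrow\gamma$ is left-$\mu$-homogeneous if $\mathcal{V}ar^\mu(\lambda)\cap\overline{\mathcal{V}ar}^\mu(\lambda)=\emptyset$, and $\mu$-compatible if $\mathcal{V}ar^\mu(\lambda)\cap\overline{\mathcal{V}ar}^\mu(\rho)=\emptyset$ and no variable of $\mathcal{V}ar^\mu(\lambda)$ occurs in $\gamma$. An EGTRS is $\mathcal R=(\mathcal F,\Pi,\mu,E,H,R)$ with $\Pi$ a predicate signature containing binary $=,\to,\to^*$; $E$ conditional equations $s=t\Leftarrow c$; $H$ definite Horn clauses $A\Leftarrow c$ with head predicate not $=,\to,\to^*$; $R$ rules $\ell\to r\Leftarrow c$, $\ell\notin\mathcal X$; each $c$ a finite sequence of atoms; it is assumed that $=$ does not depend on $R$ (a predicate $P$ depends on $R$ if $P\in\{\to,\to^*\}$ or some clause of $E\cup H$ with head predicate $P$ has a body atom whose predicate depends on $R$). $\overleftrightarrow E=\{s\to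 t\Leftarrow c,\ t\to s\Leftarrow c\mid s=t\Leftarrow c\in E\}$. $R^{rm}$: $R$ with $\approx$ replaced by new $\approx_{rm}$; $H^{rm}$: $H$ with $\approx,\to,\to^*$ replaced by new $\approx_{rm},\to_{rm},\to^*_{rm}$. $\mathsf{Th}^{CR}$: universal closures of (a) reflexivity, symmetry, transitivity of $=$, $x_i=y_i\Rightarrow f(..x_i..)=f(..y_i..)$ ($i\in\mu(f)$), $A_1\wedge..\wedge A_n\Rightarrow s=t$ for equations of $E$; (b) $x\to^*x$, $x\to y\wedge y\to^*z\Rightarrow x\to^*z$, $x_i\to y_i\Rightarrow f(..x_i..)\to f(..y_i..)$ ($i\in\mu(f)$), $A_1\wedge..\wedge A_n\Rightarrow\ell\to r$ for rules of $R^{rm}$; (c) $x\to^*_{ps}x$, $x\to_{ps}y\wedge y\to^*_{ps}z\Rightarrow x\to^*_{ps}z$, $x_i\to_{ps}y_i\Rightarrow f(..x_i..)\to_{ps}f(..y_i..)$ ($i\in\mu(f)$), $x=\ell\wedge A_1\wedge..\wedge A_n\Rightarrow x\to_{ps}r$ ($x$ fresh) for rules of $R^{rm}$; (d) $x\to^*_{rm}x$, $x\to_{rm}y\wedge y\to^*_{rm}z\Rightarrow x\to^*_{rm}z$, $x=x'\wedge x'\to y'\wedge y'=y\Rightarrow x\to_{rm}y$; (e) the clauses of $H^{rm}$. $s\to_{\mathcal R,E}t$ iff $s\to_{ps}t$ is deducible from $\mathsf{Th}^{CR}$; $s=_Et$ iff $s=t$ is deducible from (a) plus the clauses of $H$.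 A conditional pair $\langle s,t\rangle\Leftarrow A_1,..,A_n$ is joinable modulo $E$ w.r.t. $\to_{\mathcal R,E}$ if for every substitution $\sigma$ with each $\sigma(A_i)$ deducible from $\mathsf{Th}^{CR}$ there are $u,u'$ with $\sigma(s)\to^*_{\mathcal R,E}u$, $\sigma(t)\to^*_{\mathcal R,E}u'$, $u=_Eu'$; left-strictly (resp. right-strictly) if moreover $\sigma(s)\to^+_{\mathcal R,E}u$ (resp. $\sigma(t)\to^+_{\mathcal R,E}u'$). -}

module Defs where

open import Data.Nat using (ℕ; zero; suc)
open import Data.Bool using (Bool; true)
open import Data.Fin using (Fin; toℕ)
open import Data.Vec using (Vec; []; _∷_; lookup; _[_]≔_)
open import Data.List using (List; []; _∷_; map)
open import Data.List.Membership.Propositional using (_∈_)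
open import Data.List.Relation.Unary.All using (All)
open import Data.Product using (Σ; ∃; ∃-syntax; _×_; _,_)
open import Data.Sum using (_⊎_)
open import Relation.Nullary using (¬_)
open import Relation.Binary.PropositionalEquality using (_≡_; _≢_)
open import Relation.Binary.Construct.Closure.ReflexiveTransitive using (Star)
open import Relation.Binary.Construct.Closure.Transitive using (TransClosure)

record Sig : Set₁ where
  field
    Fun   : Set
    arity : Fun → ℕ
    PO    : Set          -- predicate symbols of Π ∖ {=, →, →*}
    par   : PO → ℕ

module Terms (S : Sig) where
  open Sig S

  data Term : Set where
    var : ℕ → Term
    app : (f : Fun) → Vec Term (arity f) → Term

  data PSym : Set where
    eqS redS redsS : PSym
    oth : PO → PSym

  psar : PSym → ℕ
  psar eqS = 2
  psar redS = 2
  psar redsS = 2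
  psar (oth P) = par P

  Atom : Set
  Atom = Σ PSym λ P → Vec Term (psar P)

  record Eqn : Set where
    constructor _≐_⇐_
    field
      elhs erhs : Term
      econd : List Atom

  record Horn : Set where
    field
      hpred : PO
      hargs : Vec Term (par hpred)
      hbody : List Atom

  record Rule : Set where
    field
      rlhs rrhs : Term
      rcond : List Atom

  RMap : Set
  RMap = (f : Fun) → Fin (arity f) → Bool

  -- positions (argument indices counted from 0)
  Pos : Set
  Pos = List ℕ

  data Occ : Term → ℕ → Pos → Set where
    here  : ∀ {x} → Occ (var x) x []
    under : ∀ {f ts x q} (i : Fin (arity f)) →
            Occ (lookup ts i) x q → Occ (app f ts) x (toℕ i ∷ q)

  data ActivePos (μ : RMap) : Term → Pos → Set where
    root  : ∀ {t} → ActivePos μ t []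
    under : ∀ {f ts q} (i : Fin (arity f)) → μ f i ≡ true →
            ActivePos μ (lookup ts i) q → ActivePos μ (app f ts) (toℕ i ∷ q)

  ActVarPos : RMap → Term → ℕ → Pos → Set
  ActVarPos μ t x p = Occ t x p × ActivePos μ t p

  VarAct : RMap → Term → ℕ → Set
  VarAct μ t x = ∃[ p ] ActVarPos μ t x p

  VarNonAct : RMap → Term → ℕ → Set
  VarNonAct μ t x = ∃[ p ] (Occ t x p × ¬ ActivePos μ t p)

  OccursIn : Term → ℕ → Set
  OccursIn t x = ∃[ p ] Occ t x p

  OccursInArgs : ∀ {n} → Vec Term n → ℕ → Set
  OccursInArgs ts x = ∃[ i ] OccursIn (lookup ts i) x

  OccursInAtom : Atom → ℕ → Set
  OccursInAtom (P , ts) x = OccursInArgs ts x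

  OccursInConds : List Atom → ℕ → Set
  OccursInConds c x = ∃[ A ] (A ∈ c × OccursInAtom A x)

  OccursTwice : Term → ℕ → Set
  OccursTwice t x = ∃[ p ] ∃[ q ] (p ≢ q × Occ t x p × Occ t x q)

  mutual
    _[_]←_ : Term → Pos → Term → Term
    t [ [] ]← s = s
    var y [ i ∷ q ]← s = var y
    app f ts [ i ∷ q ]← s = app f (replArgs ts i q s)

    replArgs : ∀ {n} → Vec Term n → ℕ → Pos → Term → Vec Term n
    replArgs [] i q s = []
    replArgs (t ∷ ts) zero q s = (t [ q ]← s) ∷ ts
    replArgs (t ∷ ts) (suc i) q s = t ∷ replArgs ts i q s

  Subst : Set
  Subst = ℕ → Term

  mutual
    _⟪_⟫ : Term → Subst → Term
    var x ⟪ σ ⟫ = σ x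
    app f ts ⟪ σ ⟫ = app f (substArgs ts σ)

    substArgs : ∀ {n} → Vec Term n → Subst → Vec Term n
    substArgs [] σ = []
    substArgs (t ∷ ts) σ = (t ⟪ σ ⟫) ∷ substArgs ts σ

  substAtom : Atom → Subst → Atom
  substAtom (P , ts) σ = P , substArgs ts σ

  data DependsR (E : Eqn → Set) (H : Horn → Set) : PSym → Set where
    dep-red  : DependsR E H redS
    dep-reds : DependsR E H redsS
    dep-E    : ∀ {e A} → E e → A ∈ Eqn.econd e →
               DependsR E H (Data.Product.proj₁ A) → DependsR E H eqS
    dep-H    : ∀ {h A} → H h → A ∈ Horn.hbody h →
               DependsR E H (Data.Product.proj₁ A) → DependsR E H (oth (Horn.hpred h))

record EGTRS (S : Sig) : Set₁ where
  field
    μ : Terms.RMap S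
    E : Terms.Eqn S → Set
    H : Terms.Horn S → Set
    R : Terms.Rule S → Set
    R-lhs-nonvar : ∀ {r} → R r → ∀ x → Terms.Rule.rlhs r ≢ Terms.var x
    eq-indep : ¬ Terms.DependsR S E H (Terms.eqS)

module Th {S : Sig} (𝓡 : EGTRS S) where
  open Sig S
  open Terms S public
  open EGTRS 𝓡

  -- predicate symbols of Th^CR: those of Π, their "rm" copies,
  -- and →_ps, →*_ps.
  data XPred : Set where
    orig : PSym → XPred
    rm   : PSym → XPred
    psS pssS : XPred

  xar : XPred → ℕ
  xar (orig P) = psar P
  xar (rm P) = psar P
  xar psS = 2
  xar pssS = 2

  XAtom : Set
  XAtom = Σ XPred λ P → Vec (Term) (xar P)


  origA : Atom → XAtom
  origA (P , ts) = orig P , ts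

  substX : XAtom → Subst → XAtom
  substX (P , ts) σ = P , substArgs ts σ

  data RmAtom : Atom → XAtom → Set where
    is-dep  : ∀ {P ts} → DependsR E H P → RmAtom (P , ts) (rm P , ts)
    not-dep : ∀ {P ts} → ¬ DependsR E H P → RmAtom (P , ts) (orig P , ts)

  mutual
    RmHolds : List (Atom) → Subst → Set
    RmHolds [] σ = Data.Unit.⊤
      where import Data.Unit
    RmHolds (A ∷ c) σ = (∃[ A' ] (RmAtom A A' × ⊢ substX A' σ)) × RmHolds c σ

    data ⊢_ : XAtom → Set where
      eq-refl  : ∀ t → ⊢ (orig eqS , t ∷ t ∷ [])
      eq-sym   : ∀ {s t} → ⊢ (orig eqS , s ∷ t ∷ []) → ⊢ (orig eqS , t ∷ s ∷ [])
      eq-trans : ∀ {s t u} → ⊢ (orig eqS , s ∷ t ∷ []) → ⊢ (orig eqS , t ∷ u ∷ []) →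
                 ⊢ (orig eqS , s ∷ u ∷ [])
      eq-cong  : ∀ {f} (ts : Vec (Term) (arity f)) (i : Fin (arity f)) (u : Term) →
                 μ f i ≡ true → ⊢ (orig eqS , lookup ts i ∷ u ∷ []) →
                 ⊢ (orig eqS , app f ts ∷ app f (ts [ i ]≔ u) ∷ [])
      eq-E     : ∀ {e} → E e → (σ : Subst) →
                 All (λ A → ⊢ substX (origA A) σ) (Eqn.econd e) →
                 ⊢ (orig eqS , (Eqn.elhs e ⟪ σ ⟫) ∷ (Eqn.erhs e ⟪ σ ⟫) ∷ [])
      reds-refl : ∀ t → ⊢ (orig redsS , t ∷ t ∷ [])
      reds-step : ∀ {s t u} → ⊢ (orig redS , s ∷ t ∷ []) → ⊢ (orig redsS , t ∷ u ∷ []) →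
                  ⊢ (orig redsS , s ∷ u ∷ [])
      red-cong  : ∀ {f} (ts : Vec (Term) (arity f)) (i : Fin (arity f)) (u : Term) →
                  μ f i ≡ true → ⊢ (orig redS , lookup ts i ∷ u ∷ []) →
                  ⊢ (orig redS , app f ts ∷ app f (ts [ i ]≔ u) ∷ [])
      red-rule  : ∀ {r} → R r → (σ : Subst) → RmHolds (Rule.rcond r) σ →
                  ⊢ (orig redS , (Rule.rlhs r ⟪ σ ⟫) ∷ (Rule.rrhs r ⟪ σ ⟫) ∷ [])
      pss-refl : ∀ t → ⊢ (pssS , t ∷ t ∷ [])
      pss-step : ∀ {s t u} → ⊢ (psS , s ∷ t ∷ []) → ⊢ (pssS , t ∷ u ∷ []) →
                 ⊢ (pssS , s ∷ u ∷ [])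
      ps-cong  : ∀ {f} (ts : Vec (Term) (arity f)) (i : Fin (arity f)) (u : Term) →
                 μ f i ≡ true → ⊢ (psS , lookup ts i ∷ u ∷ []) →
                 ⊢ (psS , app f ts ∷ app f (ts [ i ]≔ u) ∷ [])
      ps-rule  : ∀ {r} → R r → (σ : Subst) (s : Term) →
                 ⊢ (orig eqS , s ∷ (Rule.rlhs r ⟪ σ ⟫) ∷ []) →
                 RmHolds (Rule.rcond r) σ →
                 ⊢ (psS , s ∷ (Rule.rrhs r ⟪ σ ⟫) ∷ [])
      rmreds-refl : ∀ t → ⊢ (rm redsS , t ∷ t ∷ [])
      rmreds-step : ∀ {s t u} → ⊢ (rm redS , s ∷ t ∷ []) → ⊢ (rm redsS , t ∷ u ∷ []) →
                    ⊢ (rm redsS , s ∷ u ∷ [])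
      rmred       : ∀ {s s' t' t} → ⊢ (orig eqS , s ∷ s' ∷ []) →
                    ⊢ (orig redS , s' ∷ t' ∷ []) → ⊢ (orig eqS , t' ∷ t ∷ []) →
                    ⊢ (rm redS , s ∷ t ∷ [])
      H-rm : ∀ {h} → H h → (σ : Subst) → (A' : XAtom) →
             RmAtom (oth (Horn.hpred h) , Horn.hargs h) A' →
             RmHolds (Horn.hbody h) σ → ⊢ substX A' σ

  data ⊢E_ : Atom → Set where
    eq-refl  : ∀ t → ⊢E (eqS , t ∷ t ∷ [])
    eq-sym   : ∀ {s t} → ⊢E (eqS , s ∷ t ∷ []) → ⊢E (eqS , t ∷ s ∷ [])
    eq-trans : ∀ {s t u} → ⊢E (eqS , s ∷ t ∷ []) → ⊢E (eqS , t ∷ u ∷ []) →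
               ⊢E (eqS , s ∷ u ∷ [])
    eq-cong  : ∀ {f} (ts : Vec (Term) (arity f)) (i : Fin (arity f)) (u : Term) →
               μ f i ≡ true → ⊢E (eqS , lookup ts i ∷ u ∷ []) →
               ⊢E (eqS , app f ts ∷ app f (ts [ i ]≔ u) ∷ [])
    eq-E     : ∀ {e} → E e → (σ : Subst) →
               All (λ A → ⊢E substAtom A σ) (Eqn.econd e) →
               ⊢E (eqS , (Eqn.elhs e ⟪ σ ⟫) ∷ (Eqn.erhs e ⟪ σ ⟫) ∷ [])
    H-cl     : ∀ {h} → H h → (σ : Subst) →
               All (λ A → ⊢E substAtom A σ) (Horn.hbody h) →
               ⊢E (oth (Horn.hpred h) , substArgs (Horn.hargs h) σ)

  _=E_ : Term → Term → Set
  s =E t = ⊢E (eqS , s ∷ t ∷ [])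

  _⟶RE_ : Term → Term → Set
  s ⟶RE t = ⊢ (psS , s ∷ t ∷ [])

  _⟶*RE_ : Term → Term → Set
  _⟶*RE_ = Star _⟶RE_

  _⟶+RE_ : Term → Term → Set
  _⟶+RE_ = TransClosure _⟶RE_

  record CPair : Set where
    constructor ⟨_,_⟩⇐_
    field
      cl cr : Term
      ccond : List XAtom

  Premises : CPair → Subst → Set
  Premises π σ = All (λ A → ⊢ substX A σ) (CPair.ccond π)

  JoinableE : CPair → Set
  JoinableE π = ∀ (σ : Subst) → Premises π σ →
    ∃[ u ] ∃[ u' ] ((CPair.cl π ⟪ σ ⟫) ⟶*RE u × (CPair.cr π ⟪ σ ⟫) ⟶*RE u' × u =E u')

  LeftStrictlyJoinableE : CPair → Set
  LeftStrictlyJoinableE π = ∀ (σ : Subst) → Premises π σ →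
    ∃[ u ] ∃[ u' ] ((CPair.cl π ⟪ σ ⟫) ⟶+RE u × (CPair.cr π ⟪ σ ⟫) ⟶*RE u' × u =E u')

  RightStrictlyJoinableE : CPair → Set
  RightStrictlyJoinableE π = ∀ (σ : Subst) → Premises π σ →
    ∃[ u ] ∃[ u' ] ((CPair.cl π ⟪ σ ⟫) ⟶*RE u × (CPair.cr π ⟪ σ ⟫) ⟶+RE u' × u =E u')

  InSymE : Term → Term → List (Atom) → Set
  InSymE l r c = ∃[ e ] (E e × ((e ≡ (l ≐ r ⇐ c)) ⊎ (e ≡ (r ≐ l ⇐ c))))

  LeftHomogeneous : Term → Set
  LeftHomogeneous l = ∀ x → VarAct μ l x → ¬ VarNonAct μ l x

  Compatible : Term → Term → List (Atom) → Set
  Compatible l r c = ∀ x → VarAct μ l x → ¬ VarNonAct μ r x × ¬ OccursInConds c x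

  Fresh : ℕ → Term → Term → List (Atom) → Set
  Fresh y l r c = ¬ OccursIn l y × ¬ OccursIn r y × ¬ OccursInConds c y

  πps : Term → Term → List (Atom) → ℕ → Pos → ℕ → CPair
  πps l r c x p x' =
    ⟨ (l [ p ]← var x') , r ⟩⇐ ((psS , var x ∷ var x' ∷ []) ∷ map origA c)

{-# OPTIONS --safe #-}
-- Let σ satisfy the premises and put τ := σ[x ↦ σ x′]. As = does not depend on R, the
-- instantiated conditions γσ are consequences of E and H alone, and γ does not mention x
-- (μ-compatibility), so γτ holds and λτ =E ρτ. Every occurrence of x in λ and in ρ is active
-- (left-μ-homogeneity, μ-compatibility), so rewriting σ x →ps σ x′ at each of them gives
-- (λ[x′]_p)σ →* λτ and ρσ →* ρτ; these reductions are non-empty as soon as x occurs in λ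
-- at a position other than p, resp. occurs in ρ at all.
module Submission where

open import Defs
open import Data.Nat as ℕ using (ℕ; _≟_)
open import Data.Fin using (Fin; zero; suc; toℕ)
open import Data.Fin.Properties as Fin using (toℕ-injective)
import Data.Bool.Properties as Bool
open import Data.Bool using (true)
open import Data.Vec using (Vec; []; _∷_; lookup; _[_]≔_)
open import Data.List using (List; []; _∷_)
open import Data.List.Properties using (≡-dec)
open import Data.List.Membership.Propositional using (_∈_)
open import Data.List.Relation.Unary.Any using (here; there)
open import Data.List.Relation.Unary.All using (All; []; _∷_)
open import Data.List.Relation.Unary.All.Properties using (map⁻)
open import Data.Product using (_×_; _,_; proj₁; proj₂; ∃-syntax)
open import Data.Sum using (_⊎_; inj₁; inj₂)
open import Data.Unit using (⊤; tt)
open import Data.Empty using (⊥-elim)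
open import Function using (_∘_)
open import Relation.Nullary using (¬_; yes; no)
open import Relation.Nullary.Decidable using (decidable-stable)
open import Relation.Binary.PropositionalEquality using (_≡_; _≢_; refl; sym; trans; cong; cong₂; subst)
open import Relation.Binary.Construct.Closure.ReflexiveTransitive using (Star; ε; _◅_; _◅◅_; gmap)
open import Relation.Binary.Construct.Closure.Transitive using (TransClosure; [_]; _∷_; _∷ʳ_)

module _ {A : Set} {_∼_ : A → A → Set} where

  gmap⁺ : ∀ {B : Set} {_≈_ : B → B → Set} (f : A → B) → (∀ {a b} → a ∼ b → f a ≈ f b) →
          ∀ {a b} → TransClosure _∼_ a b → TransClosure _≈_ (f a) (f b)
  gmap⁺ f g [ s ]    = [ g s ]
  gmap⁺ f g (s ∷ r) = g s ∷ gmap⁺ f g r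

  infixr 5 _◅◅⁺_ _⁺◅◅_

  _◅◅⁺_ : ∀ {a b c} → Star _∼_ a b → TransClosure _∼_ b c → TransClosure _∼_ a c
  ε       ◅◅⁺ r′ = r′
  (s ◅ r) ◅◅⁺ r′ = s ∷ (r ◅◅⁺ r′)

  _⁺◅◅_ : ∀ {a b c} → TransClosure _∼_ a b → Star _∼_ b c → TransClosure _∼_ a c
  r ⁺◅◅ ε        = r
  r ⁺◅◅ (s ◅ r′) = (r ∷ʳ s) ⁺◅◅ r′

module _ {S : Sig} where
  open Terms S

  lookup-replArgs-here : ∀ {n} (ts : Vec Term n) i q s →
                         lookup (replArgs ts (toℕ i) q s) i ≡ lookup ts i [ q ]← s
  lookup-replArgs-here (t ∷ ts) zero    q s = refl
  lookup-replArgs-here (t ∷ ts) (suc i) q s = lookup-replArgs-here ts i q s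

  lookup-replArgs-elsewhere : ∀ {n} (ts : Vec Term n) {i j} q s → j ≢ i →
                              lookup (replArgs ts (toℕ i) q s) j ≡ lookup ts j
  lookup-replArgs-elsewhere (t ∷ ts) {zero}  {zero}  q s j≢i = ⊥-elim (j≢i refl)
  lookup-replArgs-elsewhere (t ∷ ts) {zero}  {suc j} q s j≢i = refl
  lookup-replArgs-elsewhere (t ∷ ts) {suc i} {zero}  q s j≢i = refl
  lookup-replArgs-elsewhere (t ∷ ts) {suc i} {suc j} q s j≢i =
    lookup-replArgs-elsewhere ts q s (j≢i ∘ cong suc)

  mutual
    ⟪⟫-cong-vars : ∀ {σ τ} (t : Term) → (∀ y → OccursIn t y → σ y ≡ τ y) → t ⟪ σ ⟫ ≡ t ⟪ τ ⟫
    ⟪⟫-cong-vars (var y)    agree = agree y ([] , here)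
    ⟪⟫-cong-vars (app f ts) agree =
      cong (app f) (substArgs-cong-vars ts λ y (j , q , o) → agree y (toℕ j ∷ q , under j o))

    substArgs-cong-vars : ∀ {n σ τ} (ts : Vec Term n) → (∀ y → OccursInArgs ts y → σ y ≡ τ y) →
                          substArgs ts σ ≡ substArgs ts τ
    substArgs-cong-vars []       agree = refl
    substArgs-cong-vars (t ∷ ts) agree =
      cong₂ _∷_ (⟪⟫-cong-vars t λ y o → agree y (zero , o))
                (substArgs-cong-vars ts λ y (j , o) → agree y (suc j , o))

  All-substAtom-cong-vars : ∀ (Q : Atom → Set) {σ τ} (c : List Atom) →
                            (∀ y → OccursInConds c y → σ y ≡ τ y) →
                            All (λ A → Q (substAtom A σ)) c → All (λ A → Q (substAtom A τ)) c
  All-substAtom-cong-vars Q []             agree []         = []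
  All-substAtom-cong-vars Q ((P , ts) ∷ c) agree (qA ∷ qc) =
    subst (Q ∘ (P ,_)) (substArgs-cong-vars ts λ y o → agree y (_ , here refl , o)) qA
    ∷ All-substAtom-cong-vars Q c (λ y (A , A∈c , o) → agree y (A , there A∈c , o)) qc

  _[_↦_] : Subst → ℕ → Term → Subst
  (σ [ x ↦ v ]) y with y ≟ x
  ... | yes _ = v
  ... | no  _ = σ y

  [↦]-same : ∀ σ x v → (σ [ x ↦ v ]) x ≡ v
  [↦]-same σ x v with x ≟ x
  ... | yes _   = refl
  ... | no  x≢x = ⊥-elim (x≢x refl)

  [↦]-other : ∀ σ x v {y} → y ≢ x → (σ [ x ↦ v ]) y ≡ σ y
  [↦]-other σ x v {y} y≢x with y ≟ x
  ... | yes y≡x = ⊥-elim (y≢x y≡x)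
  ... | no  _   = refl

  another-occurrence : ∀ {t x} → OccursTwice t x → ∀ p → ∃[ q ] (q ≢ p × Occ t x q)
  another-occurrence (q₁ , q₂ , q₁≢q₂ , o₁ , o₂) p with ≡-dec _≟_ q₁ p
  ... | yes refl = q₂ , q₁≢q₂ ∘ sym , o₂
  ... | no  q₁≢p = q₁ , q₁≢p , o₁

  module _ (μ : RMap) where

    ActivePos-under⁻ : ∀ {f ts q} j → ActivePos μ (app f ts) (toℕ j ∷ q) →
                       μ f j ≡ true × ActivePos μ (lookup ts j) q
    ActivePos-under⁻ {f} {ts} {q} j a = invert a refl
      where
      invert : ∀ {k} → ActivePos μ (app f ts) (k ∷ q) → toℕ j ≡ k →
               μ f j ≡ true × ActivePos μ (lookup ts j) q
      invert (under i m a) j≡i with toℕ-injective j≡i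
      ... | refl = m , a

    ¬VarNonAct-arg : ∀ {f ts x} → ¬ VarNonAct μ (app f ts) x → ∀ j → ¬ VarNonAct μ (lookup ts j) x
    ¬VarNonAct-arg nna j (q , o , inactive) =
      nna (toℕ j ∷ q , under j o , inactive ∘ proj₂ ∘ ActivePos-under⁻ j)

    ¬VarNonAct⇒active-arg : ∀ {f ts x j q} → ¬ VarNonAct μ (app f ts) x → Occ (lookup ts j) x q →
                            μ f j ≡ true
    ¬VarNonAct⇒active-arg {f} {j = j} nna o = decidable-stable (μ f j Bool.≟ true) λ inactive →
      nna (_ , under j o , inactive ∘ proj₁ ∘ ActivePos-under⁻ j)

module ArgumentwiseReduction {S : Sig} (_⟶_ : Terms.Term S → Terms.Term S → Set) where
  open Terms S

  MonotoneOn : ∀ {n} → (Fin n → Set) → (Vec Term n → Term) → Set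
  MonotoneOn P G = ∀ us i {u} → P i → lookup us i ⟶ u → G us ⟶ G (us [ i ]≔ u)

  ReducesIf : Set → Term → Term → Set
  ReducesIf P a b = a ≡ b ⊎ (P × Star _⟶_ a b)

  module _ {n} {P : Fin (ℕ.suc n) → Set} {G : Vec Term (ℕ.suc n) → Term} (mono : MonotoneOn P G) where

    MonotoneOn-tail : ∀ w → MonotoneOn (P ∘ suc) (G ∘ (w ∷_))
    MonotoneOn-tail w us i = mono (w ∷ us) (suc i)

    head-⟶* : ∀ {a b} vs → ReducesIf (P zero) a b → Star _⟶_ (G (a ∷ vs)) (G (b ∷ vs))
    head-⟶* vs (inj₁ refl)    = ε
    head-⟶* vs (inj₂ (p , r)) = gmap (G ∘ (_∷ vs)) (λ s → mono (_ ∷ vs) zero p s) r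

    head-⟶+ : ∀ {a b} vs → P zero → TransClosure _⟶_ a b →
              TransClosure _⟶_ (G (a ∷ vs)) (G (b ∷ vs))
    head-⟶+ vs p = gmap⁺ (G ∘ (_∷ vs)) (λ s → mono (_ ∷ vs) zero p s)

  module _ {σ τ : Subst} where

    substArgs-⟶* : ∀ {n P G} → MonotoneOn P G → (ss ts : Vec Term n) →
                   (∀ j → ReducesIf (P j) (lookup ss j ⟪ σ ⟫) (lookup ts j ⟪ τ ⟫)) →
                   Star _⟶_ (G (substArgs ss σ)) (G (substArgs ts τ))
    substArgs-⟶* mono []       []       args = ε
    substArgs-⟶* mono (s ∷ ss) (t ∷ ts) args =
      head-⟶* mono _ (args zero) ◅◅ substArgs-⟶* (MonotoneOn-tail mono _) ss ts (args ∘ suc)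

    substArgs-⟶+ : ∀ {n P G} → MonotoneOn P G → (ss ts : Vec Term n) →
                   (∀ j → ReducesIf (P j) (lookup ss j ⟪ σ ⟫) (lookup ts j ⟪ τ ⟫)) →
                   ∀ k → P k → TransClosure _⟶_ (lookup ss k ⟪ σ ⟫) (lookup ts k ⟪ τ ⟫) →
                   TransClosure _⟶_ (G (substArgs ss σ)) (G (substArgs ts τ))
    substArgs-⟶+ mono (s ∷ ss) (t ∷ ts) args zero p r =
      head-⟶+ mono _ p r ⁺◅◅ substArgs-⟶* (MonotoneOn-tail mono _) ss ts (args ∘ suc)
    substArgs-⟶+ mono (s ∷ ss) (t ∷ ts) args (suc k) p r =
      head-⟶* mono _ (args zero) ◅◅⁺ substArgs-⟶+ (MonotoneOn-tail mono _) ss ts (args ∘ suc) k p r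

module _ {S : Sig} (𝓡 : EGTRS S) where
  open Th 𝓡
  open EGTRS 𝓡

  Independent : List Atom → Set
  Independent c = ∀ {A} → A ∈ c → ¬ DependsR E H (proj₁ A)

  ⊢E-ifIndependent : XAtom → Set
  ⊢E-ifIndependent (orig P , ts) = ¬ DependsR E H P → ⊢E (P , ts)
  ⊢E-ifIndependent _             = ⊤

  mutual
    ⊢⇒⊢E : ∀ {A} → ⊢ A → ⊢E-ifIndependent A
    ⊢⇒⊢E (eq-refl t)          ind = eq-refl t
    ⊢⇒⊢E (eq-sym d)           ind = eq-sym (⊢⇒⊢E d ind)
    ⊢⇒⊢E (eq-trans d d′)      ind = eq-trans (⊢⇒⊢E d ind) (⊢⇒⊢E d′ ind)
    ⊢⇒⊢E (eq-cong ts i u m d) ind = eq-cong ts i u m (⊢⇒⊢E d ind)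
    ⊢⇒⊢E (eq-E Ee σ ds)       ind = eq-E Ee σ (All⊢⇒All⊢E σ ds λ A∈ → ind ∘ dep-E Ee A∈)
    ⊢⇒⊢E (reds-refl _)        ind = ⊥-elim (ind dep-reds)
    ⊢⇒⊢E (reds-step _ _)      ind = ⊥-elim (ind dep-reds)
    ⊢⇒⊢E (red-cong _ _ _ _ _) ind = ⊥-elim (ind dep-red)
    ⊢⇒⊢E (red-rule _ _ _)     ind = ⊥-elim (ind dep-red)
    ⊢⇒⊢E (H-rm Hh σ _ (not-dep ind) hs) _ =
      H-cl Hh σ (RmHolds⇒All⊢E σ hs λ A∈ → ind ∘ dep-H Hh A∈)
    ⊢⇒⊢E {rm _ , _} _ = tt
    ⊢⇒⊢E {psS , _}  _ = tt
    ⊢⇒⊢E {pssS , _} _ = tt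

    All⊢⇒All⊢E : ∀ {c} σ → All (λ A → ⊢ substX (origA A) σ) c → Independent c →
                 All (λ A → ⊢E substAtom A σ) c
    All⊢⇒All⊢E σ []       ind = []
    All⊢⇒All⊢E σ (d ∷ ds) ind = ⊢⇒⊢E d (ind (here refl)) ∷ All⊢⇒All⊢E σ ds (ind ∘ there)

    RmHolds⇒All⊢E : ∀ {c} σ → RmHolds c σ → Independent c → All (λ A → ⊢E substAtom A σ) c
    RmHolds⇒All⊢E {[]}    σ _                          ind = []
    RmHolds⇒All⊢E {_ ∷ _} σ ((_ , is-dep dep , _) , _) ind = ⊥-elim (ind (here refl) dep)
    RmHolds⇒All⊢E {_ ∷ _} σ ((_ , not-dep _ , d) , hs) ind =
      ⊢⇒⊢E d (ind (here refl)) ∷ RmHolds⇒All⊢E σ hs (ind ∘ there)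

  InSymE-independent : ∀ {l r c} → InSymE l r c → Independent c
  InSymE-independent (_ , Ee , inj₁ refl) A∈ = eq-indep ∘ dep-E Ee A∈
  InSymE-independent (_ , Ee , inj₂ refl) A∈ = eq-indep ∘ dep-E Ee A∈

  InSymE-instance : ∀ {l r c σ} → InSymE l r c → All (λ A → ⊢E substAtom A σ) c →
                    (l ⟪ σ ⟫) =E (r ⟪ σ ⟫)
  InSymE-instance (_ , Ee , inj₁ refl) conds = eq-E Ee _ conds
  InSymE-instance (_ , Ee , inj₂ refl) conds = eq-sym (eq-E Ee _ conds)

  πps-premises⇒ : ∀ {l r c x p x′} → InSymE l r c → ¬ OccursInConds c x →
                 ∀ σ → Premises (πps l r c x p x′) σ →
                 σ x ⟶RE σ x′ × (l ⟪ σ [ x ↦ σ x′ ] ⟫) =E (r ⟪ σ [ x ↦ σ x′ ] ⟫)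
  πps-premises⇒ {c = c} {x} {x′ = x′} β x∉c σ (x⟶x′ ∷ conds) =
    x⟶x′ , InSymE-instance β (All-substAtom-cong-vars ⊢E_ c unchanged
                               (All⊢⇒All⊢E σ (map⁻ conds) (InSymE-independent β)))
    where
    unchanged : ∀ y → OccursInConds c y → σ y ≡ (σ [ x ↦ σ x′ ]) y
    unchanged y y∈c = sym ([↦]-other σ x (σ x′) λ { refl → x∉c y∈c })

module InstanceReduction {S : Sig} (𝓡 : EGTRS S) (x : ℕ) {σ : Terms.Subst S} {v : Terms.Term S}
                         (x⟶v : Th._⟶RE_ 𝓡 (σ x) v) where
  open Th 𝓡
  open EGTRS 𝓡 using (μ)
  open ArgumentwiseReduction _⟶RE_

  τ : Subst
  τ = σ [ x ↦ v ]

  app-monotone : ∀ f → MonotoneOn (λ i → μ f i ≡ true) (app f)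
  app-monotone f us i = ps-cong us i _

  ⟪⟫-unchanged : ∀ t → ¬ OccursIn t x → t ⟪ σ ⟫ ≡ t ⟪ τ ⟫
  ⟪⟫-unchanged t x∉t = ⟪⟫-cong-vars t λ y y∈t → sym ([↦]-other σ x v λ { refl → x∉t y∈t })

  mutual
    instance-⟶* : ∀ t → ¬ VarNonAct μ t x → (t ⟪ σ ⟫) ⟶*RE (t ⟪ τ ⟫)
    instance-⟶* (var y)    _ with y ≟ x
    ... | yes refl = x⟶v ◅ ε
    ... | no  _    = ε
    instance-⟶* (app f ts) nna = substArgs-⟶* (app-monotone f) ts ts (args-⟶* ts nna)

    args-⟶* : ∀ {f} ts → ¬ VarNonAct μ (app f ts) x →
              ∀ j → ReducesIf (μ f j ≡ true) (lookup ts j ⟪ σ ⟫) (lookup ts j ⟪ τ ⟫)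
    args-⟶* {f} ts nna j with μ f j Bool.≟ true
    ... | yes active   = inj₂ (active , lookup-⟶* ts j (¬VarNonAct-arg μ nna j))
    ... | no  inactive =
      inj₁ (⟪⟫-unchanged (lookup ts j) λ (_ , o) → inactive (¬VarNonAct⇒active-arg μ nna o))

    -- Recursing along the vector (rather than calling instance-⟶* on lookup ts j) keeps
    -- the recursion structural.
    lookup-⟶* : ∀ {n} (ts : Vec Term n) j → ¬ VarNonAct μ (lookup ts j) x →
                (lookup ts j ⟪ σ ⟫) ⟶*RE (lookup ts j ⟪ τ ⟫)
    lookup-⟶* (t ∷ ts) zero    = instance-⟶* t
    lookup-⟶* (t ∷ ts) (suc j) = lookup-⟶* ts j

  instance-⟶+ : ∀ {t q} → Occ t x q → ¬ VarNonAct μ t x → (t ⟪ σ ⟫) ⟶+RE (t ⟪ τ ⟫)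
  instance-⟶+ here                 _   = [ subst (σ x ⟶RE_) (sym ([↦]-same σ x v)) x⟶v ]
  instance-⟶+ (under {f} {ts} i o) nna =
    substArgs-⟶+ (app-monotone f) ts ts (args-⟶* ts nna) i (¬VarNonAct⇒active-arg μ nna o)
                 (instance-⟶+ o (¬VarNonAct-arg μ nna i))

  module _ {x′ : ℕ} (σx′≡v : σ x′ ≡ v) where

    mutual
      replaced-instance-⟶* : ∀ {t p} → Occ t x p → ¬ VarNonAct μ t x →
                             ((t [ p ]← var x′) ⟪ σ ⟫) ⟶*RE (t ⟪ τ ⟫)
      replaced-instance-⟶* here _ = subst (σ x′ ⟶*RE_) (trans σx′≡v (sym ([↦]-same σ x v))) ε
      replaced-instance-⟶* (under {f} {ts} {q = q} i o) nna =
        substArgs-⟶* (app-monotone f) (replArgs ts (toℕ i) q (var x′)) ts (replaced-args-⟶* i o nna)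

      replaced-args-⟶* : ∀ {f ts q} i → Occ (lookup ts i) x q → ¬ VarNonAct μ (app f ts) x → ∀ j →
                         ReducesIf (μ f j ≡ true) (lookup (replArgs ts (toℕ i) q (var x′)) j ⟪ σ ⟫)
                                                  (lookup ts j ⟪ τ ⟫)
      replaced-args-⟶* {ts = ts} {q} i o nna j with j Fin.≟ i
      ... | yes refl rewrite lookup-replArgs-here ts i q (var x′) =
        inj₂ (¬VarNonAct⇒active-arg μ nna o , replaced-instance-⟶* o (¬VarNonAct-arg μ nna i))
      ... | no  j≢i  rewrite lookup-replArgs-elsewhere ts q (var x′) j≢i = args-⟶* ts nna j

    replaced-instance-⟶+ : ∀ {t p q} → Occ t x p → Occ t x q → q ≢ p → ¬ VarNonAct μ t x →
                           ((t [ p ]← var x′) ⟪ σ ⟫) ⟶+RE (t ⟪ τ ⟫)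
    replaced-instance-⟶+ here here q≢p _ = ⊥-elim (q≢p refl)
    replaced-instance-⟶+ (under {f} {ts} {q = p} i o) (under j o′) q≢p nna with j Fin.≟ i
    ... | yes refl =
      substArgs-⟶+ (app-monotone f) _ ts (replaced-args-⟶* i o nna) i (¬VarNonAct⇒active-arg μ nna o)
        (subst (λ s → (s ⟪ σ ⟫) ⟶+RE _) (sym (lookup-replArgs-here ts i p (var x′)))
          (replaced-instance-⟶+ o o′ (q≢p ∘ cong (toℕ i ∷_)) (¬VarNonAct-arg μ nna i)))
    ... | no  j≢i  =
      substArgs-⟶+ (app-monotone f) _ ts (replaced-args-⟶* i o nna) j (¬VarNonAct⇒active-arg μ nna o′)
        (subst (λ s → (s ⟪ σ ⟫) ⟶+RE _) (sym (lookup-replArgs-elsewhere ts p (var x′) j≢i))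
          (instance-⟶+ o′ (¬VarNonAct-arg μ nna j)))

proposition10p22 : (S : Sig) (𝓡 : EGTRS S) →
    let open Th 𝓡 in
    (l r : Term) (c : List (Atom)) →
    InSymE l r c → LeftHomogeneous l → Compatible l r c →
    (x : ℕ) (p : Pos) → ActVarPos (EGTRS.μ 𝓡) l x p →
    (x' : ℕ) → Fresh x' l r c →
    JoinableE (πps l r c x p x')
    × (OccursTwice l x → LeftStrictlyJoinableE (πps l r c x p x'))
    × (VarAct (EGTRS.μ 𝓡) r x → RightStrictlyJoinableE (πps l r c x p x'))
proposition10p22 S 𝓡 l r c β homogeneous compatible x p (occ , act) x′ _ =
    (λ σ prem → _ , _ , At.left σ prem , At.right σ prem , At.β-instance σ prem)
  , (λ twice σ prem → _ , _ , At.left⁺ σ prem twice , At.right σ prem , At.β-instance σ prem)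
  , (λ x∈Varμr σ prem → _ , _ , At.left σ prem , At.right⁺ σ prem x∈Varμr , At.β-instance σ prem)
  where
  open Th 𝓡
  x∈Varμl : VarAct (EGTRS.μ 𝓡) l x
  x∈Varμl = p , occ , act

  module At (σ : Subst) (prem : Premises (πps l r c x p x′) σ) where
    premises : σ x ⟶RE σ x′ × (l ⟪ σ [ x ↦ σ x′ ] ⟫) =E (r ⟪ σ [ x ↦ σ x′ ] ⟫)
    premises = πps-premises⇒ 𝓡 {p = p} β (proj₂ (compatible x x∈Varμl)) σ prem
    open InstanceReduction 𝓡 x {σ} (proj₁ premises)

    β-instance : (l ⟪ τ ⟫) =E (r ⟪ τ ⟫)
    β-instance = proj₂ premises
    left : ((l [ p ]← var x′) ⟪ σ ⟫) ⟶*RE (l ⟪ τ ⟫)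
    left = replaced-instance-⟶* refl occ (homogeneous x x∈Varμl)
    right : (r ⟪ σ ⟫) ⟶*RE (r ⟪ τ ⟫)
    right = instance-⟶* r (proj₁ (compatible x x∈Varμl))
    left⁺ : OccursTwice l x → ((l [ p ]← var x′) ⟪ σ ⟫) ⟶+RE (l ⟪ τ ⟫)
    left⁺ twice = let (q , q≢p , occ′) = another-occurrence twice p in
      replaced-instance-⟶+ refl occ occ′ q≢p (homogeneous x x∈Varμl)
    right⁺ : VarAct (EGTRS.μ 𝓡) r x → (r ⟪ σ ⟫) ⟶+RE (r ⟪ τ ⟫)
    right⁺ (_ , occʳ , _) = instance-⟶+ occʳ (proj₁ (compatible x x∈Varμl))
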